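{- Let $A$ be a poset and let $(U, V, W)$ be a partition of $A$. Then $(U,V,W)$ is a valid triple for $A$ if and only if: $u < w$ for all $u \in U$, $w \in W$; $\neg(u > v)$ for all $u \in U$, $v \in V$; and $\neg(w < v)$ for all $w \in W$, $v \in V$.
   Context: A partition $(U,V,W)$ of a poset $A$ (parts possibly empty) is a valid triple for $A$ if there exists a poset $E = A \cup \{e\}$ with $e \notin A$, extending $A$ (i.e. the order of $E$ restricted to $A$ is that of $A$), such that $U = \{a \in A : a < e\}$, $V = \{a \in A : a \text{ and } e \text{ are incomparable}\}$, $W = \{a \in A : a > e\}$. -}

module Defs where

open import Level using (Level; _⊔_)
open import Data.Maybe using (Maybe; just; nothing)
open import Data.Product using (_×_; Σ-syntax)
open import Data.Sum using (_⊎_)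
open import Relation.Nullary using (¬_)
open import Relation.Unary using (Pred)
open import Relation.Binary using (Rel; IsPartialOrder)
open import Relation.Binary.PropositionalEquality using (_≡_; _≢_)
open import Function.Bundles using (_⇔_)

Strict : ∀ {a ℓ} {A : Set a} → Rel A ℓ → Rel A (a ⊔ ℓ)
Strict _≤_ x y = x ≤ y × x ≢ y

Incomparable : ∀ {a ℓ} {A : Set a} → Rel A ℓ → Rel A ℓ
Incomparable _≤_ x y = ¬ (x ≤ y) × ¬ (y ≤ x)

IsPartition : ∀ {a p} {A : Set a} → Pred A p → Pred A p → Pred A p → Set (a ⊔ p)
IsPartition U V W =
  ∀ x → (U x ⊎ V x ⊎ W x) × ¬ (U x × V x) × ¬ (U x × W x) × ¬ (V x × W x)

-- Valid triple: there is a poset E on A ∪ {e} (modelled as Maybe A, with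
-- e = nothing) extending the order of A, such that
-- U = {a : a < e}, V = {a : a ∥ e}, W = {a : a > e}.
ValidTriple : ∀ {a ℓ p} {A : Set a} (_≤_ : Rel A ℓ) →
  Pred A p → Pred A p → Pred A p → Set (Level.suc ℓ ⊔ a ⊔ p)
ValidTriple {ℓ = ℓ} {A = A} _≤_ U V W =
  Σ[ _≤E_ ∈ Rel (Maybe A) ℓ ]
    ( IsPartialOrder _≡_ _≤E_
    × (∀ x y → (just x ≤E just y) ⇔ (x ≤ y))
    × (∀ x → U x ⇔ Strict _≤E_ (just x) nothing)
    × (∀ x → V x ⇔ Incomparable _≤E_ (just x) nothing)
    × (∀ x → W x ⇔ Strict _≤E_ nothing (just x)) )

{-# OPTIONS --safe #-}
module Submission where

-- Adjoining e to A amounts to choosing a cut: {a < e} must be a down-set,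
-- {a > e} an up-set lying entirely above it, and the rest is incomparable to e.
-- Given the partition, the three conditions make U a down-set and W an up-set
-- with U < W, so adjoining e between U and W gives the required poset;
-- conversely, the conditions follow by transitivity through e.

open import Defs
open import Level using (Level; _⊔_; Lift; lift)
open import Data.Product using (_×_; _,_; proj₁; proj₂)
open import Data.Product.Function.NonDependent.Propositional using (_×-⇔_)
open import Data.Sum using (inj₁; inj₂)
open import Data.Unit.Polymorphic using (⊤)
open import Data.Empty using (⊥-elim)
open import Data.Maybe using (Maybe; just; nothing)
open import Relation.Nullary using (¬_)
open import Relation.Unary using (Pred)
open import Relation.Binary using (Rel; IsPartialOrder; Antisymmetric)
open import Relation.Binary.PropositionalEquality using (_≡_; refl; sym; cong; subst; isEquivalence)
  renaming (trans to ≡-trans)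
open import Function using (_∘_)
open import Function.Bundles using (_⇔_; mk⇔; Equivalence)
open import Function.Related.TypeIsomorphisms using (¬-cong-⇔)
import Function.Properties.Equivalence as ⇔

private variable
  a ℓ p : Level
  A : Set a

Admissible : {A : Set a} → Rel A ℓ → (U V W : Pred A p) → Set (a ⊔ ℓ ⊔ p)
Admissible _≤_ U V W =
  (∀ u w → U u → W w → Strict _≤_ u w)
  × (∀ u v → U u → V v → ¬ Strict _≤_ v u)
  × (∀ w v → W w → V v → ¬ Strict _≤_ w v)

validTriple⇒admissible : {_≤_ : Rel A ℓ} {U V W : Pred A p} →
  ValidTriple _≤_ U V W → Admissible _≤_ U V W
validTriple⇒admissible {_≤_ = _≤_} {U} {V} {W} (_ , isPO , embed , U⇔<e , V⇔∥e , W⇔>e) =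
  U<W , ¬V<U , ¬W<V
  where
  open IsPartialOrder isPO using (trans; antisym)
  open Equivalence

  U<W : ∀ u w → U u → W w → Strict _≤_ u w
  U<W u w Uu Ww = to (embed u w) (trans u≤e e≤w) , u≢w
    where
    u≤e = proj₁ (to (U⇔<e u) Uu)
    e≤w = proj₁ (to (W⇔>e w) Ww)
    u≢w : ¬ u ≡ w
    u≢w refl = proj₂ (to (U⇔<e u) Uu) (antisym u≤e e≤w)

  ¬V<U : ∀ u v → U u → V v → ¬ Strict _≤_ v u
  ¬V<U u v Uu Vv (v≤u , _) =
    proj₁ (to (V⇔∥e v) Vv) (trans (from (embed v u) v≤u) (proj₁ (to (U⇔<e u) Uu)))

  ¬W<V : ∀ w v → W w → V v → ¬ Strict _≤_ w v
  ¬W<V w v Ww Vv (w≤v , _) =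
    proj₂ (to (V⇔∥e v) Vv) (trans (proj₁ (to (W⇔>e w) Ww)) (from (embed w v) w≤v))

module Cut {_≤_ : Rel A ℓ} (isPartialOrder : IsPartialOrder _≡_ _≤_)
  (L H : Pred A ℓ)
  (L-downward : ∀ {x y} → x ≤ y → L y → L x)
  (H-upward : ∀ {x y} → x ≤ y → H x → H y)
  (L≤H : ∀ {x y} → L x → H y → x ≤ y)
  (L∩H-empty : ∀ {x} → L x → ¬ H x)
  where
  open IsPartialOrder isPartialOrder using (antisym; trans) renaming (refl to ≤-refl)

  infix 4 _≤⁺_
  _≤⁺_ : Rel (Maybe A) ℓ
  just x  ≤⁺ just y  = x ≤ y
  just x  ≤⁺ nothing = L x
  nothing ≤⁺ just y  = H y
  nothing ≤⁺ nothing = ⊤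

  ≤⁺-reflexive : ∀ {x y} → x ≡ y → x ≤⁺ y
  ≤⁺-reflexive {just x}  refl = ≤-refl
  ≤⁺-reflexive {nothing} refl = _

  ≤⁺-trans : ∀ {x y z} → x ≤⁺ y → y ≤⁺ z → x ≤⁺ z
  ≤⁺-trans {just x}  {just y}  {just z}  x≤y y≤z = trans x≤y y≤z
  ≤⁺-trans {just x}  {just y}  {nothing} x≤y Ly  = L-downward x≤y Ly
  ≤⁺-trans {just x}  {nothing} {just z}  Lx  Hz  = L≤H Lx Hz
  ≤⁺-trans {just x}  {nothing} {nothing} Lx  _   = Lx
  ≤⁺-trans {nothing} {just y}  {just z}  Hy  y≤z = H-upward y≤z Hy
  ≤⁺-trans {nothing} {just y}  {nothing} _   _   = _
  ≤⁺-trans {nothing} {nothing} {just z}  _   Hz  = Hz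
  ≤⁺-trans {nothing} {nothing} {nothing} _   _   = _

  ≤⁺-antisym : ∀ {x y} → x ≤⁺ y → y ≤⁺ x → x ≡ y
  ≤⁺-antisym {just x}  {just y}  x≤y y≤x = cong just (antisym x≤y y≤x)
  ≤⁺-antisym {just x}  {nothing} Lx  Hx  = ⊥-elim (L∩H-empty Lx Hx)
  ≤⁺-antisym {nothing} {just y}  Hy  Ly  = ⊥-elim (L∩H-empty Ly Hy)
  ≤⁺-antisym {nothing} {nothing} _   _   = refl

  ≤⁺-isPartialOrder : IsPartialOrder _≡_ _≤⁺_
  ≤⁺-isPartialOrder = record
    { isPreorder = record
      { isEquivalence = isEquivalence
      ; reflexive = ≤⁺-reflexive
      ; trans = λ {x y z} → ≤⁺-trans {x} {y} {z}
      }
    ; antisym = ≤⁺-antisym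
    }

  L⇔below : ∀ x → L x ⇔ Strict _≤⁺_ (just x) nothing
  L⇔below x = mk⇔ (_, λ ()) proj₁

  H⇔above : ∀ x → H x ⇔ Strict _≤⁺_ nothing (just x)
  H⇔above x = mk⇔ (_, λ ()) proj₁

data Position : Set where
  below incomparable above : Position

module _ {U V W : Pred A p} (partition : IsPartition U V W) where

  position : A → Position
  position x with proj₁ (partition x)
  ... | inj₁ _        = below
  ... | inj₂ (inj₁ _) = incomparable
  ... | inj₂ (inj₂ _) = above

  U⇔below : ∀ x → U x ⇔ position x ≡ below
  U⇔below x with partition x
  ... | inj₁ Ux        , _                 = mk⇔ (λ _ → refl) (λ _ → Ux)
  ... | inj₂ (inj₁ Vx) , U∩V-empty , _     = mk⇔ (λ Ux → ⊥-elim (U∩V-empty (Ux , Vx))) λ ()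
  ... | inj₂ (inj₂ Wx) , _ , U∩W-empty , _ = mk⇔ (λ Ux → ⊥-elim (U∩W-empty (Ux , Wx))) λ ()

  W⇔above : ∀ x → W x ⇔ position x ≡ above
  W⇔above x with partition x
  ... | inj₁ Ux        , _ , U∩W-empty , _ = mk⇔ (λ Wx → ⊥-elim (U∩W-empty (Ux , Wx))) λ ()
  ... | inj₂ (inj₁ Vx) , _ , _ , V∩W-empty = mk⇔ (λ Wx → ⊥-elim (V∩W-empty (Vx , Wx))) λ ()
  ... | inj₂ (inj₂ Wx) , _                 = mk⇔ (λ _ → refl) (λ _ → Wx)

  V⇔¬U×¬W : ∀ x → V x ⇔ (¬ U x × ¬ W x)
  V⇔¬U×¬W x with partition x
  ... | inj₁ Ux , U∩V-empty , _ =
    mk⇔ (λ Vx → ⊥-elim (U∩V-empty (Ux , Vx))) (λ (¬Ux , _) → ⊥-elim (¬Ux Ux))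
  ... | inj₂ (inj₁ Vx) , U∩V-empty , _ , V∩W-empty =
    mk⇔ (λ _ → (λ Ux → U∩V-empty (Ux , Vx)) , (λ Wx → V∩W-empty (Vx , Wx))) (λ _ → Vx)
  ... | inj₂ (inj₂ Wx) , _ , _ , V∩W-empty =
    mk⇔ (λ Vx → ⊥-elim (V∩W-empty (Vx , Wx))) (λ (_ , ¬Wx) → ⊥-elim (¬Wx Wx))

module _ {_≤_ : Rel A ℓ} (antisym : Antisymmetric _≡_ _≤_)
  {U V W : Pred A p} (partition : IsPartition U V W)
  (U<W : ∀ u w → U u → W w → Strict _≤_ u w)
  where

  U-downward : (∀ u v → U u → V v → ¬ Strict _≤_ v u) →
    ∀ {x y} → x ≤ y → U y → U x
  U-downward ¬V<U {x} {y} x≤y Uy with partition x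
  ... | inj₁ Ux        , _ = Ux
  ... | inj₂ (inj₁ Vx) , U∩V-empty , _ = ⊥-elim (¬V<U y x Uy Vx (x≤y , x≢y))
    where
    x≢y : ¬ x ≡ y
    x≢y refl = U∩V-empty (Uy , Vx)
  ... | inj₂ (inj₂ Wx) , _ , U∩W-empty , _ =
    ⊥-elim (U∩W-empty (Ux , Wx))
    where
    Ux = subst U (antisym (proj₁ (U<W y x Uy Wx)) x≤y) Uy

  W-upward : (∀ w v → W w → V v → ¬ Strict _≤_ w v) →
    ∀ {x y} → x ≤ y → W x → W y
  W-upward ¬W<V {x} {y} x≤y Wx with partition y
  ... | inj₂ (inj₂ Wy) , _ = Wy
  ... | inj₂ (inj₁ Vy) , _ , _ , V∩W-empty = ⊥-elim (¬W<V x y Wx Vy (x≤y , x≢y))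
    where
    x≢y : ¬ x ≡ y
    x≢y refl = V∩W-empty (Vy , Wx)
  ... | inj₁ Uy , _ , U∩W-empty , _ =
    ⊥-elim (U∩W-empty (Uy , Wy))
    where
    Wy = subst W (antisym x≤y (proj₁ (U<W y x Uy Wx))) Wx

admissible⇒validTriple : {_≤_ : Rel A ℓ} → IsPartialOrder _≡_ _≤_ →
  {U V W : Pred A p} → IsPartition U V W →
  Admissible _≤_ U V W → ValidTriple _≤_ U V W
admissible⇒validTriple {ℓ = ℓ} {_≤_ = _≤_} isPO {U = U} {W = W} partition (U<W , ¬V<U , ¬W<V) =
  _≤⁺_ , ≤⁺-isPartialOrder , (λ _ _ → ⇔.refl)
  , (λ x → ⇔.trans (U⇔Below x) (L⇔below x))
  , (λ x → ⇔.trans (V⇔¬U×¬W partition x) (¬-cong-⇔ (U⇔Below x) ×-⇔ ¬-cong-⇔ (W⇔Above x)))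
  , (λ x → ⇔.trans (W⇔Above x) (H⇔above x))
  where
  open IsPartialOrder isPO using (antisym)
  open Equivalence

  -- The order on Maybe A must live in the level ℓ of _≤_, while U and W live in
  -- level p, so membership is read off the small classifier position instead.
  Below Above : Pred _ ℓ
  Below x = Lift ℓ (position partition x ≡ below)
  Above x = Lift ℓ (position partition x ≡ above)

  U⇔Below : ∀ x → U x ⇔ Below x
  U⇔Below x = mk⇔ (lift ∘ to (U⇔below partition x)) (λ (lift p) → from (U⇔below partition x) p)

  W⇔Above : ∀ x → W x ⇔ Above x
  W⇔Above x = mk⇔ (lift ∘ to (W⇔above partition x)) (λ (lift p) → from (W⇔above partition x) p)

  Below∩Above-empty : ∀ {x} → Below x → ¬ Above x
  Below∩Above-empty (lift p) (lift q) with () ← ≡-trans (sym p) q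

  open Cut isPO Below Above
    (λ {x} {y} x≤y → to (U⇔Below x) ∘ U-downward antisym partition U<W ¬V<U x≤y ∘ from (U⇔Below y))
    (λ {x} {y} x≤y → to (W⇔Above y) ∘ W-upward antisym partition U<W ¬W<V x≤y ∘ from (W⇔Above x))
    (λ {x} {y} Lx Hy → proj₁ (U<W x y (from (U⇔Below x) Lx) (from (W⇔Above y) Hy)))
    Below∩Above-empty

lemma2p4 : ∀ {a ℓ p} {A : Set a} (_≤_ : Rel A ℓ) → IsPartialOrder _≡_ _≤_ →
    (U V W : Pred A p) → IsPartition U V W →
    ValidTriple _≤_ U V W ⇔
      ((∀ u w → U u → W w → Strict _≤_ u w)
      × (∀ u v → U u → V v → ¬ Strict _≤_ v u)
      × (∀ w v → W w → V v → ¬ Strict _≤_ w v))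
lemma2p4 _≤_ isPO U V W partition =
  mk⇔ validTriple⇒admissible (admissible⇒validTriple isPO partition)
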